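{- Let $G=\langle \rho_0, \rho_1, \rho_2 \mid \rho_0^2, \rho_1^2, \rho_2^2, (\rho_0\rho_2)^2\rangle$. Then the derived subgroup of $G$ is $G'=\langle [\rho_0, \rho_1], [\rho_1, \rho_2], [\rho_0, \rho_1]^{\rho_2}\rangle$.
   Context: $[x,y]=x^{ -1}y^{ -1}xy$ and $x^g=g^{ -1}xg$. $G'$ is the subgroup generated by all commutators $[x,y]$, $x,y\in G$. -}

module Defs where

open import Data.Nat using (ℕ)
open import Data.Fin using (Fin; zero; suc)
open import Data.Bool using (Bool; true; false; not)
open import Data.Product using (_×_; _,_; ∃-syntax)
open import Data.Sum using (_⊎_)
open import Data.List using (List; []; _∷_; _++_; reverse; map)
open import Data.List.Membership.Propositional using (_∈_)
open import Relation.Binary.PropositionalEquality using (_≡_)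

-- Finitely presented groups ⟨ x_0 … x_{n-1} | R ⟩, realised as words in the
-- free group modulo the congruence generated by free reduction and relators.

-- A letter is a generator index with an exponent sign (true = +1, false = -1).
Letter : ℕ → Set
Letter n = Fin n × Bool

Word : ℕ → Set
Word n = List (Letter n)

letterInv : ∀ {n} → Letter n → Letter n
letterInv (i , b) = (i , not b)

winv : ∀ {n} → Word n → Word n
winv w = reverse (map letterInv w)

gen : ∀ {n} → Fin n → Word n
gen i = (i , true) ∷ []

data _⊢_≈_ {n : ℕ} (R : List (Word n)) : Word n → Word n → Set where
  ≈-refl  : ∀ {u} → R ⊢ u ≈ u
  ≈-sym   : ∀ {u v} → R ⊢ u ≈ v → R ⊢ v ≈ u
  ≈-trans : ∀ {u v w} → R ⊢ u ≈ v → R ⊢ v ≈ w → R ⊢ u ≈ w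
  ≈-free  : ∀ u v a → R ⊢ (u ++ a ∷ letterInv a ∷ v) ≈ (u ++ v)
  ≈-rel   : ∀ u v r → r ∈ R → R ⊢ (u ++ r ++ v) ≈ (u ++ v)

comm : ∀ {n} → Word n → Word n → Word n
comm x y = winv x ++ winv y ++ x ++ y

conj : ∀ {n} → Word n → Word n → Word n
conj x g = winv g ++ x ++ g

data Gen {n : ℕ} (R : List (Word n)) (S : Word n → Set) : Word n → Set where
  g-gen : ∀ {w} → S w → Gen R S w
  g-one : Gen R S []
  g-mul : ∀ {u v} → Gen R S u → Gen R S v → Gen R S (u ++ v)
  g-inv : ∀ {u} → Gen R S u → Gen R S (winv u)
  g-eq  : ∀ {u v} → R ⊢ u ≈ v → Gen R S u → Gen R S v

IsCommutator : ∀ {n} → Word n → Set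
IsCommutator {n} w = ∃[ x ] ∃[ y ] (w ≡ comm {n} x y)

Derived : ∀ {n} → List (Word n) → Word n → Set
Derived R = Gen R IsCommutator

ρ₀ ρ₁ ρ₂ : Word 3
ρ₀ = gen zero
ρ₁ = gen (suc zero)
ρ₂ = gen (suc (suc zero))

relsG : List (Word 3)
relsG = (ρ₀ ++ ρ₀) ∷ (ρ₁ ++ ρ₁) ∷ (ρ₂ ++ ρ₂) ∷ (ρ₀ ++ ρ₂ ++ ρ₀ ++ ρ₂) ∷ []

Gens4p2 : Word 3 → Set
Gens4p2 w = (w ≡ comm ρ₀ ρ₁) ⊎ (w ≡ comm ρ₁ ρ₂) ⊎ (w ≡ conj (comm ρ₀ ρ₁) ρ₂)

module Submission where

-- Let H = ⟨[ρ₀,ρ₁], [ρ₁,ρ₂], [ρ₀,ρ₁]^ρ₂⟩.  The inclusion H ⊆ G' is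
-- immediate, since [ρ₀,ρ₁]^ρ₂ = [ρ₀^ρ₂, ρ₁^ρ₂].  For G' ⊆ H it suffices that
-- H contains every commutator [x,y], and by the identities
--   [uv, y] = [u,y]^v [v,y]   and   [x, uv] = [x,v] [x,u]^v
-- this follows, by induction on the words x and y, as soon as H is normal and
-- contains the commutators of single letters.  Normality in turn only has to
-- be checked on the generators of H conjugated by single letters.

open import Defs
open import Data.Product using (_×_; _,_; proj₁)
open import Data.Sum using (inj₁; inj₂)
open import Level using (0ℓ)
open import Data.Nat using (ℕ)
open import Data.Fin using (Fin; zero; suc)
open import Data.Bool using (true; false)
open import Data.Bool.Properties using (not-involutive)
open import Data.List using (List; []; _∷_; _++_; [_]; reverse; map)
open import Data.List.Properties
  using (++-assoc; ++-identityʳ; ++-monoid; map-++; reverse-++; reverse-map; reverse-involutive)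
open import Data.List.Membership.Propositional using (_∈_)
open import Data.List.Relation.Unary.Any using (here; there)
open import Relation.Binary.Bundles using (Setoid)
open import Relation.Binary.PropositionalEquality as ≡ using (_≡_; refl; cong; cong₂)
import Relation.Binary.Reasoning.Setoid as SetoidReasoning
open import Tactic.MonoidSolver using (solve)

module Presentation {n : ℕ} {R : List (Word n)} where

  wordSetoid : Setoid 0ℓ 0ℓ
  wordSetoid = record
    { Carrier = Word n
    ; _≈_ = R ⊢_≈_
    ; isEquivalence = record { refl = ≈-refl ; sym = ≈-sym ; trans = ≈-trans }
    }

  open SetoidReasoning wordSetoid

  ≡⇒≈ : ∀ {u v : Word n} → u ≡ v → R ⊢ u ≈ v
  ≡⇒≈ refl = ≈-refl

  ++-congˡ : ∀ {u v} (p : Word n) → R ⊢ u ≈ v → R ⊢ (p ++ u) ≈ (p ++ v)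
  ++-congˡ [] u≈v = u≈v
  ++-congˡ (l ∷ p) u≈v = ∷-cong (++-congˡ p u≈v)
    where
    ∷-cong : ∀ {u v} → R ⊢ u ≈ v → R ⊢ (l ∷ u) ≈ (l ∷ v)
    ∷-cong ≈-refl = ≈-refl
    ∷-cong (≈-sym e) = ≈-sym (∷-cong e)
    ∷-cong (≈-trans e f) = ≈-trans (∷-cong e) (∷-cong f)
    ∷-cong (≈-free u v a) = ≈-free (l ∷ u) v a
    ∷-cong (≈-rel u v r r∈R) = ≈-rel (l ∷ u) v r r∈R

  ++-congʳ : ∀ {u v} (q : Word n) → R ⊢ u ≈ v → R ⊢ (u ++ q) ≈ (v ++ q)
  ++-congʳ q ≈-refl = ≈-refl
  ++-congʳ q (≈-sym e) = ≈-sym (++-congʳ q e)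
  ++-congʳ q (≈-trans e f) = ≈-trans (++-congʳ q e) (++-congʳ q f)
  ++-congʳ q (≈-free u v a) = begin
    (u ++ a ∷ letterInv a ∷ v) ++ q  ≡⟨ ++-assoc u _ q ⟩
    u ++ a ∷ letterInv a ∷ v ++ q    ≈⟨ ≈-free u (v ++ q) a ⟩
    u ++ v ++ q                      ≡⟨ ++-assoc u v q ⟨
    (u ++ v) ++ q                    ∎
  ++-congʳ q (≈-rel u v r r∈R) = begin
    (u ++ r ++ v) ++ q  ≡⟨ solve (++-monoid (Letter n)) ⟩
    u ++ r ++ v ++ q    ≈⟨ ≈-rel u (v ++ q) r r∈R ⟩
    u ++ v ++ q         ≡⟨ ++-assoc u v q ⟨
    (u ++ v) ++ q       ∎

  winv-++ : ∀ (u v : Word n) → winv (u ++ v) ≡ winv v ++ winv u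
  winv-++ u v = ≡.trans (cong reverse (map-++ letterInv u v))
                        (reverse-++ (map letterInv u) (map letterInv v))

  winv-involutive : ∀ (u : Word n) → winv (winv u) ≡ u
  winv-involutive u = ≡.trans (cong reverse (reverse-map letterInv (map letterInv u)))
                              (≡.trans (reverse-involutive _) (map-letterInv² u))
    where
    map-letterInv² : ∀ (u : Word n) → map letterInv (map letterInv u) ≡ u
    map-letterInv² [] = refl
    map-letterInv² ((i , b) ∷ u) = cong₂ _∷_ (cong (i ,_) (not-involutive b)) (map-letterInv² u)

  -- winv u is a two-sided inverse of u; stated with a tail v to be usable
  -- inside longer words.
  inverseʳ : ∀ (u v : Word n) → R ⊢ (u ++ winv u ++ v) ≈ v
  inverseʳ [] v = ≈-refl
  inverseʳ (l ∷ u) v = begin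
    l ∷ u ++ winv (l ∷ u) ++ v          ≡⟨ cong (λ z → l ∷ u ++ z ++ v) (winv-++ [ l ] u) ⟩
    l ∷ u ++ (winv u ++ [ letterInv l ]) ++ v
                                        ≡⟨ cong (λ z → l ∷ u ++ z) (++-assoc (winv u) _ v) ⟩
    l ∷ u ++ winv u ++ letterInv l ∷ v  ≈⟨ ++-congˡ [ l ] (inverseʳ u (letterInv l ∷ v)) ⟩
    l ∷ letterInv l ∷ v                 ≈⟨ ≈-free [] v l ⟩
    v                                   ∎

  inverseˡ : ∀ (u v : Word n) → R ⊢ (winv u ++ u ++ v) ≈ v
  inverseˡ u v = ≡.subst (λ z → R ⊢ (winv u ++ z ++ v) ≈ v)
                         (winv-involutive u) (inverseʳ (winv u) v)

  conj-++ : ∀ u v g → R ⊢ (conj u g ++ conj v g) ≈ conj (u ++ v) g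
  conj-++ u v g = begin
    conj u g ++ conj v g                      ≡⟨ solve (++-monoid (Letter n)) ⟩
    (winv g ++ u) ++ g ++ winv g ++ (v ++ g)  ≈⟨ ++-congˡ (winv g ++ u) (inverseʳ g _) ⟩
    (winv g ++ u) ++ v ++ g                   ≡⟨ solve (++-monoid (Letter n)) ⟩
    conj (u ++ v) g                           ∎

  conj-winv : ∀ u g → R ⊢ winv (conj u g) ≈ conj (winv u) g
  conj-winv u g = begin
    winv (winv g ++ u ++ g)            ≡⟨ winv-++ (winv g) (u ++ g) ⟩
    winv (u ++ g) ++ winv (winv g)     ≡⟨ cong₂ _++_ (winv-++ u g) (winv-involutive g) ⟩
    (winv g ++ winv u) ++ g            ≡⟨ ++-assoc (winv g) (winv u) g ⟩
    winv g ++ winv u ++ g              ∎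

  conj-cong : ∀ {u v} g → R ⊢ u ≈ v → R ⊢ conj u g ≈ conj v g
  conj-cong g u≈v = ++-congˡ (winv g) (++-congʳ g u≈v)

  conj-conj : ∀ h a b → conj (conj h a) b ≡ conj h (a ++ b)
  conj-conj h a b = ≡.trans reassociate (cong (λ z → z ++ h ++ a ++ b) (≡.sym (winv-++ a b)))
    where
    reassociate : conj (conj h a) b ≡ (winv b ++ winv a) ++ h ++ a ++ b
    reassociate = solve (++-monoid (Letter n))

  comm-++ˡ : ∀ u v y → R ⊢ comm (u ++ v) y ≈ (conj (comm u y) v ++ comm v y)
  comm-++ˡ u v y = ≈-sym (begin
    conj (comm u y) v ++ comm v y
      ≡⟨ solve (++-monoid (Letter n)) ⟩
    (winv v ++ winv u ++ winv y ++ u ++ y) ++ v ++ winv v ++ (winv y ++ v ++ y)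
      ≈⟨ ++-congˡ (winv v ++ winv u ++ winv y ++ u ++ y) (inverseʳ v _) ⟩
    (winv v ++ winv u ++ winv y ++ u ++ y) ++ winv y ++ v ++ y
      ≡⟨ solve (++-monoid (Letter n)) ⟩
    (winv v ++ winv u ++ winv y ++ u) ++ y ++ winv y ++ (v ++ y)
      ≈⟨ ++-congˡ (winv v ++ winv u ++ winv y ++ u) (inverseʳ y _) ⟩
    (winv v ++ winv u ++ winv y ++ u) ++ v ++ y
      ≡⟨ solve (++-monoid (Letter n)) ⟩
    (winv v ++ winv u) ++ winv y ++ (u ++ v) ++ y
      ≡⟨ cong (λ z → z ++ winv y ++ (u ++ v) ++ y) (winv-++ u v) ⟨
    comm (u ++ v) y ∎)

  comm-++ʳ : ∀ x u v → R ⊢ comm x (u ++ v) ≈ (comm x v ++ conj (comm x u) v)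
  comm-++ʳ x u v = ≈-sym (begin
    comm x v ++ conj (comm x u) v
      ≡⟨ solve (++-monoid (Letter n)) ⟩
    (winv x ++ winv v ++ x) ++ v ++ winv v ++ (winv x ++ winv u ++ x ++ u ++ v)
      ≈⟨ ++-congˡ (winv x ++ winv v ++ x) (inverseʳ v _) ⟩
    (winv x ++ winv v ++ x) ++ winv x ++ winv u ++ x ++ u ++ v
      ≡⟨ solve (++-monoid (Letter n)) ⟩
    (winv x ++ winv v) ++ x ++ winv x ++ (winv u ++ x ++ u ++ v)
      ≈⟨ ++-congˡ (winv x ++ winv v) (inverseʳ x _) ⟩
    (winv x ++ winv v) ++ winv u ++ x ++ u ++ v
      ≡⟨ solve (++-monoid (Letter n)) ⟩
    winv x ++ (winv v ++ winv u) ++ x ++ u ++ v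
      ≡⟨ cong (λ z → winv x ++ z ++ x ++ u ++ v) (winv-++ u v) ⟨
    comm x (u ++ v) ∎)

module GeneratedSubgroup {n : ℕ} {R : List (Word n)} where
  open Presentation {n} {R}

  Gen-⊆ : ∀ {S T : Word n → Set} → (∀ {w} → S w → Gen R T w) → ∀ {w} → Gen R S w → Gen R T w
  Gen-⊆ S⊆T (g-gen s) = S⊆T s
  Gen-⊆ S⊆T g-one = g-one
  Gen-⊆ S⊆T (g-mul p q) = g-mul (Gen-⊆ S⊆T p) (Gen-⊆ S⊆T q)
  Gen-⊆ S⊆T (g-inv p) = g-inv (Gen-⊆ S⊆T p)
  Gen-⊆ S⊆T (g-eq e p) = g-eq e (Gen-⊆ S⊆T p)

  -- Conjugates of the generators by single letters stay in ⟨S⟩; this is all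
  -- that has to be checked for ⟨S⟩ to be normal.
  NormalOnGenerators : (Word n → Set) → Set
  NormalOnGenerators S = ∀ {s} → S s → ∀ l → Gen R S (conj s [ l ])

  conj-closed : ∀ {S} → NormalOnGenerators S → ∀ g {h} → Gen R S h → Gen R S (conj h g)
  conj-closed normal [] {h} p = g-eq (≡⇒≈ (≡.sym (++-identityʳ h))) p
  conj-closed normal (l ∷ g) {h} p =
    g-eq (≡⇒≈ (conj-conj h [ l ] g)) (conj-closed normal g (conj-by-letter p))
    where
    conj-by-letter : ∀ {h} → Gen R _ h → Gen R _ (conj h [ l ])
    conj-by-letter (g-gen s) = normal s l
    conj-by-letter g-one = g-eq (≈-sym (inverseˡ [ l ] [])) g-one
    conj-by-letter (g-mul {u} {v} p q) =
      g-eq (conj-++ u v [ l ]) (g-mul (conj-by-letter p) (conj-by-letter q))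
    conj-by-letter (g-inv {u} p) = g-eq (conj-winv u [ l ]) (g-inv (conj-by-letter p))
    conj-by-letter (g-eq e p) = g-eq (conj-cong [ l ] e) (conj-by-letter p)

  -- A normal ⟨S⟩ containing all commutators of letters contains all
  -- commutators: induct on y, then on x, via the commutator identities.
  comm-closed : ∀ {S} → NormalOnGenerators S → (∀ l m → Gen R S (comm [ l ] [ m ])) →
                ∀ x y → Gen R S (comm x y)
  comm-closed normal letters [] y =
    g-eq (≈-sym (≈-trans (≡⇒≈ (cong (winv y ++_) (≡.sym (++-identityʳ y)))) (inverseˡ y [])))
         g-one
  comm-closed normal letters (l ∷ x) y =
    g-eq (≈-sym (comm-++ˡ [ l ] x y))
         (g-mul (conj-closed normal x (comm-letter y)) (comm-closed normal letters x y))
    where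
    comm-letter : ∀ y → Gen R _ (comm [ l ] y)
    comm-letter [] = g-eq (≈-sym (inverseˡ [ l ] [])) g-one
    comm-letter (m ∷ y) =
      g-eq (≈-sym (comm-++ʳ [ l ] [ m ] y))
           (g-mul (comm-letter y) (conj-closed normal y (letters l m)))

open Presentation {3} {relsG}
open GeneratedSubgroup {3} {relsG}

_~_ : Word 3 → Word 3 → Set
u ~ v = relsG ⊢ u ≈ v

pattern i₀ = zero
pattern i₁ = suc zero
pattern i₂ = suc (suc zero)

square∈relsG : ∀ i → (gen i ++ gen i) ∈ relsG
square∈relsG i₀ = here refl
square∈relsG i₁ = there (here refl)
square∈relsG i₂ = there (there (here refl))

ρ₀ρ₂²∈relsG : (ρ₀ ++ ρ₂ ++ ρ₀ ++ ρ₂) ∈ relsG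
ρ₀ρ₂²∈relsG = there (there (there (here refl)))

-- Every generator is an involution, so each letter equals its positive form.
letter-positive : ∀ (l : Letter 3) w → (l ∷ w) ~ (gen (proj₁ l) ++ w)
letter-positive (i , true) w = ≈-refl
letter-positive (i , false) w = begin
  (i , false) ∷ w                             ≈⟨ ≈-rel [ (i , false) ] w _ (square∈relsG i) ⟨
  (i , false) ∷ (i , true) ∷ (i , true) ∷ w  ≈⟨ ≈-free [] _ (i , false) ⟩
  (i , true) ∷ w                              ∎
  where open SetoidReasoning wordSetoid

-- ρ₀ and ρ₂ commute: ρ₂ρ₀ = ρ₀ρ₀ρ₂ρ₀ρ₂ρ₂ = ρ₀ρ₂.
ρ₂ρ₀~ρ₀ρ₂ : ∀ w → (ρ₂ ++ ρ₀ ++ w) ~ (ρ₀ ++ ρ₂ ++ w)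
ρ₂ρ₀~ρ₀ρ₂ w = begin
  ρ₂ ++ ρ₀ ++ w                            ≈⟨ ≈-rel [] _ _ (square∈relsG i₀) ⟨
  ρ₀ ++ ρ₀ ++ ρ₂ ++ ρ₀ ++ w                 ≈⟨ ≈-rel (ρ₀ ++ ρ₀ ++ ρ₂ ++ ρ₀) w _ (square∈relsG i₂) ⟨
  ρ₀ ++ (ρ₀ ++ ρ₂ ++ ρ₀ ++ ρ₂) ++ ρ₂ ++ w   ≈⟨ ≈-rel ρ₀ (ρ₂ ++ w) _ ρ₀ρ₂²∈relsG ⟩
  ρ₀ ++ ρ₂ ++ w                            ∎
  where open SetoidReasoning wordSetoid

-- Normal forms: lists of generator indices, read as positive words, in which
-- no index is repeated consecutively and ρ₀ always precedes an adjacent ρ₂.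
⌜_⌝ : List (Fin 3) → Word 3
⌜ s ⌝ = map (_, true) s

push : Fin 3 → List (Fin 3) → List (Fin 3)
push i [] = [ i ]
push i₀ (i₀ ∷ s) = s
push i₁ (i₁ ∷ s) = s
push i₂ (i₂ ∷ s) = s
push i₂ (i₀ ∷ s) = i₀ ∷ push i₂ s
push i (j ∷ s) = i ∷ j ∷ s

push-sound : ∀ i s → (gen i ++ ⌜ s ⌝) ~ ⌜ push i s ⌝
push-sound i [] = ≈-refl
push-sound i₀ (i₀ ∷ s) = ≈-rel [] ⌜ s ⌝ _ (square∈relsG i₀)
push-sound i₀ (i₁ ∷ s) = ≈-refl
push-sound i₀ (i₂ ∷ s) = ≈-refl
push-sound i₁ (i₀ ∷ s) = ≈-refl
push-sound i₁ (i₁ ∷ s) = ≈-rel [] ⌜ s ⌝ _ (square∈relsG i₁)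
push-sound i₁ (i₂ ∷ s) = ≈-refl
push-sound i₂ (i₀ ∷ s) = ≈-trans (ρ₂ρ₀~ρ₀ρ₂ ⌜ s ⌝) (++-congˡ ρ₀ (push-sound i₂ s))
push-sound i₂ (i₁ ∷ s) = ≈-refl
push-sound i₂ (i₂ ∷ s) = ≈-rel [] ⌜ s ⌝ _ (square∈relsG i₂)

nf : Word 3 → List (Fin 3)
nf [] = []
nf (l ∷ w) = push (proj₁ l) (nf w)

nf-sound : ∀ w → w ~ ⌜ nf w ⌝
nf-sound [] = ≈-refl
nf-sound (l ∷ w) = ≈-trans (++-congˡ [ l ] (nf-sound w))
                     (≈-trans (letter-positive l ⌜ nf w ⌝) (push-sound (proj₁ l) (nf w)))

-- Words with equal normal forms are equal in G; this decides the concrete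
-- equalities below by computation.
by-normal-form : ∀ {u v} → nf u ≡ nf v → u ~ v
by-normal-form {u} {v} nfu≡nfv =
  ≈-trans (nf-sound u) (≈-trans (≡⇒≈ (cong ⌜_⌝ nfu≡nfv)) (≈-sym (nf-sound v)))

H : Word 3 → Set
H = Gen relsG Gens4p2

[ρ₀,ρ₁]∈H : H (comm ρ₀ ρ₁)
[ρ₀,ρ₁]∈H = g-gen (inj₁ refl)

[ρ₁,ρ₂]∈H : H (comm ρ₁ ρ₂)
[ρ₁,ρ₂]∈H = g-gen (inj₂ (inj₁ refl))

[ρ₀,ρ₁]^ρ₂∈H : H (conj (comm ρ₀ ρ₁) ρ₂)
[ρ₀,ρ₁]^ρ₂∈H = g-gen (inj₂ (inj₂ refl))

-- H is normal.  Only the index of a letter matters, since ρᵢ⁻¹ = ρᵢ; e.g.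
-- [ρ₁,ρ₂]^ρ₀ = [ρ₀,ρ₁] [ρ₁,ρ₂] ([ρ₀,ρ₁]^ρ₂)⁻¹ and ([ρ₀,ρ₁]^ρ₂)^ρ₁ =
-- [ρ₁,ρ₂] ([ρ₀,ρ₁]^ρ₂)⁻¹ [ρ₁,ρ₂]⁻¹.
H-normal : NormalOnGenerators Gens4p2
H-normal (inj₁ refl) (i₀ , _) = g-eq (by-normal-form refl) (g-inv [ρ₀,ρ₁]∈H)
H-normal (inj₁ refl) (i₁ , _) = g-eq (by-normal-form refl) (g-inv [ρ₀,ρ₁]∈H)
H-normal (inj₁ refl) (i₂ , _) = g-eq (by-normal-form refl) [ρ₀,ρ₁]^ρ₂∈H
H-normal (inj₂ (inj₁ refl)) (i₀ , _) =
  g-eq (by-normal-form refl) (g-mul [ρ₀,ρ₁]∈H (g-mul [ρ₁,ρ₂]∈H (g-inv [ρ₀,ρ₁]^ρ₂∈H)))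
H-normal (inj₂ (inj₁ refl)) (i₁ , _) = g-eq (by-normal-form refl) (g-inv [ρ₁,ρ₂]∈H)
H-normal (inj₂ (inj₁ refl)) (i₂ , _) = g-eq (by-normal-form refl) (g-inv [ρ₁,ρ₂]∈H)
H-normal (inj₂ (inj₂ refl)) (i₀ , _) = g-eq (by-normal-form refl) (g-inv [ρ₀,ρ₁]^ρ₂∈H)
H-normal (inj₂ (inj₂ refl)) (i₁ , _) =
  g-eq (by-normal-form refl) (g-mul [ρ₁,ρ₂]∈H (g-mul (g-inv [ρ₀,ρ₁]^ρ₂∈H) (g-inv [ρ₁,ρ₂]∈H)))
H-normal (inj₂ (inj₂ refl)) (i₂ , _) = g-eq (by-normal-form refl) [ρ₀,ρ₁]∈H

-- Commutators of letters lie in H: they are trivial, or [ρ₀,ρ₁]^±1 or [ρ₁,ρ₂]^±1.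
letter-comm∈H : ∀ l m → H (comm [ l ] [ m ])
letter-comm∈H (i₀ , _) (i₀ , _) = g-eq (by-normal-form refl) g-one
letter-comm∈H (i₀ , _) (i₁ , _) = g-eq (by-normal-form refl) [ρ₀,ρ₁]∈H
letter-comm∈H (i₀ , _) (i₂ , _) = g-eq (by-normal-form refl) g-one
letter-comm∈H (i₁ , _) (i₀ , _) = g-eq (by-normal-form refl) (g-inv [ρ₀,ρ₁]∈H)
letter-comm∈H (i₁ , _) (i₁ , _) = g-eq (by-normal-form refl) g-one
letter-comm∈H (i₁ , _) (i₂ , _) = g-eq (by-normal-form refl) [ρ₁,ρ₂]∈H
letter-comm∈H (i₂ , _) (i₀ , _) = g-eq (by-normal-form refl) g-one
letter-comm∈H (i₂ , _) (i₁ , _) = g-eq (by-normal-form refl) (g-inv [ρ₁,ρ₂]∈H)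
letter-comm∈H (i₂ , _) (i₂ , _) = g-eq (by-normal-form refl) g-one

-- Each generator of H is a commutator, using [ρ₀,ρ₁]^ρ₂ = [ρ₀^ρ₂, ρ₁^ρ₂].
generator-is-commutator : ∀ {w} → Gens4p2 w → Derived relsG w
generator-is-commutator (inj₁ refl) = g-gen (ρ₀ , ρ₁ , refl)
generator-is-commutator (inj₂ (inj₁ refl)) = g-gen (ρ₁ , ρ₂ , refl)
generator-is-commutator (inj₂ (inj₂ refl)) =
  g-eq (by-normal-form refl) (g-gen (conj ρ₀ ρ₂ , conj ρ₁ ρ₂ , refl))

lemma4p2 : (∀ w → Derived relsG w → Gen relsG Gens4p2 w)
         × (∀ w → Gen relsG Gens4p2 w → Derived relsG w)
lemma4p2 = (λ w → Gen-⊆ commutator∈H) , (λ w → Gen-⊆ generator-is-commutator)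
  where
  commutator∈H : ∀ {w} → IsCommutator w → H w
  commutator∈H (x , y , refl) = comm-closed H-normal letter-comm∈H x y
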